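{- Let $2\le k<t$ be integers. Among all complete multipartite graphs with $l\ge1$ parts of sizes $a_1,\dots,a_l\ge1$ satisfying $\sum_{i=1}^l a_i+l=2t-1$, let $G$ be one maximizing the number of cliques of order $k$, and let $n=\sum_i a_i$ be its number of vertices. Then for every $i$, either $a_i<3$ or $(a_i-1)^2<\frac{4n-3k+7-4a_i}{k-1}$. -}

module Defs where

open import Data.Nat using (ℕ; zero; suc; _+_; _*_; _≤_)
open import Data.List using (List; []; _∷_; length)
open import Data.Nat.ListAction using (sum)
open import Data.List.Relation.Unary.All using (All)
open import Data.Product using (_×_)

-- A complete multipartite graph K_{a_1,...,a_l} is given by the list of its
-- part sizes [a_1, ..., a_l].  A clique of order k in it is a choice of k
-- distinct parts together with one vertex from each chosen part (no two
-- vertices of the same part are adjacent, any two of different parts are).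
-- cliques k as counts exactly these: either the first part contributes no
-- vertex, or it contributes one of its a vertices.
cliques : ℕ → List ℕ → ℕ
cliques zero    _        = 1
cliques (suc k) []       = 0
cliques (suc k) (a ∷ as) = a * cliques k as + cliques (suc k) as

Admissible : ℕ → List ℕ → Set
Admissible t as = (1 ≤ length as) × All (1 ≤_) as × (sum as + length as + 1 ≡ t + t)
  where open import Relation.Binary.PropositionalEquality using (_≡_)

-- Write k = i + 2, let a ≥ 3 be a part and R the other parts, with s = ∑ R.  Splitting a into
-- parts u and v with u + v = a - 1 keeps (vertices + parts), so maximality gives
-- u v e_i(R) ≤ e_{i+1}(R) for the elementary symmetric functions e_j of R.  When all parts of R
-- are at least 1 + c, Newton's inequality s e_i ≥ (i + 1) e_{i+1} + (1 + c) i e_i turns this into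
-- s ≥ (i + 1) u v + (1 + c) i.  Taking u, v the halves of a - 1 gives, for odd a, the claimed
-- 4 s ≥ (a - 1)² (k - 1) + 3 (k - 2).  For even a = 2b + 2 the bound on s must be strict: a part 1 of R would make {2b+2, 1} ↦ {b+1, b+2} an
-- improvement, otherwise c = 1 supplies the slack when i ≥ 1, and for k = 2 either moving a
-- vertex from a to the first part of R or halving a improves the graph unless s > b (b + 1).
module Submission where

open import Defs
open import Data.Nat using (ℕ; zero; suc; _+_; _*_; _≤_; _<_; z≤n; s≤s; z<s; _≟_; _<?_; _≤?_; >-nonZero)
open import Data.Nat.Properties
open import Data.Nat.ListAction using (sum)
open import Data.Nat.ListAction.Properties using (sum-↭)
open import Data.Nat.Tactic.RingSolver using (solve-∀)
open import Data.Integer using (+_; +<+) renaming (_+_ to _+ℤ_; _*_ to _*ℤ_; _-_ to _-ℤ_; _<_ to _<ℤ_)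
open import Data.Integer.Properties using (pos-*)
import Data.Integer.Tactic.RingSolver as ℤ-Solver
open import Data.List using (List; []; _∷_; _++_; length; replicate)
open import Data.List.Properties using (length-replicate)
open import Data.List.Membership.Propositional using (_∈_)
open import Data.List.Membership.Propositional.Properties using (∈-∃++)
open import Data.List.Relation.Binary.Permutation.Propositional as ↭ using (_↭_)
open import Data.List.Relation.Binary.Permutation.Propositional.Properties using (shift; ↭-length; All-resp-↭)
open import Data.List.Relation.Unary.All as All using (All; []; _∷_)
open import Data.List.Relation.Unary.All.Properties using (¬Any⇒All¬; replicate⁺)
open import Data.List.Relation.Unary.Any using (any?)
open import Data.Sum using (_⊎_; inj₁; inj₂)
open import Data.Product using (∃; _,_; uncurry)
open import Relation.Nullary using (¬_; yes; no; contradiction)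
open import Relation.Binary.PropositionalEquality
  using (_≡_; refl; sym; trans; cong; cong₂; subst; subst₂; module ≡-Reasoning)

weight : List ℕ → ℕ
weight as = sum as + length as

cliques-one : ∀ as → cliques 1 as ≡ sum as
cliques-one []       = refl
cliques-one (a ∷ as) = cong₂ _+_ (*-identityʳ a) (cliques-one as)

cliques-swap : ∀ k a b as → cliques k (a ∷ b ∷ as) ≡ cliques k (b ∷ a ∷ as)
cliques-swap zero          a b as = refl
cliques-swap (suc zero)    a b as = identity a b (cliques 1 as)
  where
  identity : ∀ a b y → a * 1 + (b * 1 + y) ≡ b * 1 + (a * 1 + y)
  identity = solve-∀
cliques-swap (suc (suc k)) a b as = identity a b (cliques k as) (cliques (suc k) as) (cliques (suc (suc k)) as)
  where
  identity : ∀ a b x y z → a * (b * x + y) + (b * y + z) ≡ b * (a * x + y) + (a * y + z)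
  identity = solve-∀

cliques-∷ : ∀ a {as bs} → (∀ k → cliques k as ≡ cliques k bs) →
  ∀ k → cliques k (a ∷ as) ≡ cliques k (a ∷ bs)
cliques-∷ a eq zero    = refl
cliques-∷ a eq (suc k) = cong₂ (λ x y → a * x + y) (eq k) (eq (suc k))

cliques-↭ : ∀ {as bs} → as ↭ bs → ∀ k → cliques k as ≡ cliques k bs
cliques-↭ ↭.refl                   k = refl
cliques-↭ (↭.prep a p)             k = cliques-∷ a (cliques-↭ p) k
cliques-↭ (↭.swap {as} a b p)       k = trans (cliques-swap k a b as) (cliques-∷ b (cliques-∷ a (cliques-↭ p)) k)
cliques-↭ (↭.trans p q)            k = trans (cliques-↭ p k) (cliques-↭ q k)

weight-↭ : ∀ {as bs} → as ↭ bs → weight as ≡ weight bs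
weight-↭ p = cong₂ _+_ (sum-↭ p) (↭-length p)

∈⇒↭∷ : ∀ {a : ℕ} {as} → a ∈ as → ∃ λ rest → as ↭ a ∷ rest
∈⇒↭∷ a∈as with xs , ys , refl ← ∈-∃++ a∈as = xs ++ ys , shift _ xs ys

1≤cliques : ∀ k {as} → All (1 ≤_) as → k ≤ length as → 1 ≤ cliques k as
1≤cliques zero    _             _         = s≤s z≤n
1≤cliques (suc k) (1≤a ∷ 1≤as) (s≤s k≤l) =
  ≤-trans (*-mono-≤ 1≤a (1≤cliques k 1≤as k≤l)) (m≤m+n _ _)

length<⇒cliques≡0 : ∀ k as → length as < k → cliques k as ≡ 0
length<⇒cliques≡0 (suc k) []       _         = refl
length<⇒cliques≡0 (suc k) (a ∷ as) (s≤s l<k)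
  rewrite length<⇒cliques≡0 k as l<k | length<⇒cliques≡0 (suc k) as (m<n⇒m<1+n l<k) =
  trans (+-identityʳ _) (*-zeroʳ a)

1≤cliques⇒≤length : ∀ k as → 1 ≤ cliques k as → k ≤ length as
1≤cliques⇒≤length k as 1≤c with k ≤? length as
... | yes k≤l = k≤l
... | no  k≰l = contradiction (subst (1 ≤_) (length<⇒cliques≡0 k as (≰⇒> k≰l)) 1≤c) λ ()

-- cliques j as is the j-th elementary symmetric function of the part sizes.  Newton's
-- inequality for it is proved with an explicit slack D, which keeps the step a semiring identity.
newton-step : ∀ c d i s x y z {D₁ D₂} → let a = suc c + d in
  s * y ≡ suc (suc i) * z + suc c * suc i * y + D₁ →
  s * x ≡ suc i * y + suc c * i * x + D₂ →
  (a + s) * (a * x + y) ≡ suc (suc i) * (a * y + z) + suc c * suc i * (a * x + y) + (D₁ + a * D₂ + a * d * x)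
newton-step c d i s x y z {D₁} {D₂} e₁ e₂ = begin
  (a + s) * (a * x + y)                    ≡⟨ expand a s x y ⟩
  a * (s * x) + s * y + a * a * x + a * y  ≡⟨ cong₂ (λ u v → a * u + v + a * a * x + a * y) e₂ e₁ ⟩
  a * (suc i * y + suc c * i * x + D₂) + (suc (suc i) * z + suc c * suc i * y + D₁) + a * a * x + a * y
                                           ≡⟨ collect c d i x y z D₁ D₂ ⟩
  suc (suc i) * (a * y + z) + suc c * suc i * (a * x + y) + (D₁ + a * D₂ + a * d * x) ∎
  where
  open ≡-Reasoning
  a = suc c + d
  expand : ∀ a s x y → (a + s) * (a * x + y) ≡ a * (s * x) + s * y + a * a * x + a * y
  expand = solve-∀
  collect : ∀ c d i x y z D₁ D₂ → let a = suc c + d in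
    a * (suc i * y + suc c * i * x + D₂) + (suc (suc i) * z + suc c * suc i * y + D₁) + a * a * x + a * y
    ≡ suc (suc i) * (a * y + z) + suc c * suc i * (a * x + y) + (D₁ + a * D₂ + a * d * x)
  collect = solve-∀

newton-slack : ∀ c {as} → All (suc c ≤_) as → ∀ j →
  ∃ λ D → sum as * cliques j as ≡ suc j * cliques (suc j) as + suc c * j * cliques j as + D
newton-slack c {as} _ zero rewrite cliques-one as = 0 , identity (sum as) c
  where
  identity : ∀ s c → s * 1 ≡ 1 * s + suc c * 0 * 1 + 0
  identity = solve-∀
newton-slack c [] (suc i) = 0 , identity i c
  where
  identity : ∀ i c → 0 * 0 ≡ suc (suc i) * 0 + suc c * suc i * 0 + 0
  identity = solve-∀
newton-slack c {_ ∷ as} (c<a ∷ parts) (suc i)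
  with D₁ , e₁ ← newton-slack c parts (suc i) | D₂ , e₂ ← newton-slack c parts i
     | d , refl ← m≤n⇒∃[o]m+o≡n c<a =
  _ , newton-step c d i (sum as) (cliques i as) (cliques (suc i) as) (cliques (suc (suc i)) as) e₁ e₂

newton : ∀ c {as} → All (suc c ≤_) as → ∀ j →
  suc j * cliques (suc j) as + suc c * j * cliques j as ≤ sum as * cliques j as
newton c parts j with D , eq ← newton-slack c parts j = ≤-trans (m≤m+n _ D) (≤-reflexive (sym eq))

CliqueMaximal : ℕ → List ℕ → Set
CliqueMaximal k as =
  ∀ bs → All (1 ≤_) bs → 1 ≤ length bs → weight bs ≡ weight as → cliques k bs ≤ cliques k as

CliqueMaximal-↭ : ∀ {k as bs} → as ↭ bs → CliqueMaximal k as → CliqueMaximal k bs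
CliqueMaximal-↭ {k} p max cs pos len w =
  subst (cliques k cs ≤_) (cliques-↭ p k) (max cs pos len (trans w (sym (weight-↭ p))))

gain⇒≰ : ∀ {new old loss gain} → new + loss ≡ old + gain → loss < gain → ¬ new ≤ old
gain⇒≰ {new} {old} {loss} {gain} eq loss<gain new≤old = <-irrefl refl (begin-strict
  old + loss  <⟨ +-monoʳ-< old loss<gain ⟩
  old + gain  ≡⟨ sym eq ⟩
  new + loss  ≤⟨ +-monoˡ-≤ loss new≤old ⟩
  old + loss  ∎)
  where open ≤-Reasoning

split-bound : ∀ {i u v R} → 1 ≤ u → 1 ≤ v → All (1 ≤_) R →
  CliqueMaximal (suc (suc i)) (suc (u + v) ∷ R) → u * v * cliques i R ≤ cliques (suc i) R
split-bound {i} {u} {v} {R} 1≤u 1≤v pos max =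
  +-cancelʳ-≤ ((u + v) * y + z) (u * v * x) y
    (subst₂ _≤_ (split-cliques u v x y z) (merged-cliques u v y z)
      (max (u ∷ v ∷ R) (1≤u ∷ 1≤v ∷ pos) (s≤s z≤n) (split-weight u v (sum R) (length R))))
  where
  x = cliques i R
  y = cliques (suc i) R
  z = cliques (suc (suc i)) R
  split-weight : ∀ u v s l → u + (v + s) + suc (suc l) ≡ suc (u + v) + s + suc l
  split-weight = solve-∀
  split-cliques : ∀ u v x y z → u * (v * x + y) + (v * y + z) ≡ u * v * x + ((u + v) * y + z)
  split-cliques = solve-∀
  merged-cliques : ∀ u v y z → suc (u + v) * y + z ≡ y + ((u + v) * y + z)
  merged-cliques = solve-∀

split-sum-bound : ∀ c {i u v R} → 1 ≤ u → 1 ≤ v → All (suc c ≤_) R → suc i ≤ length R →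
  CliqueMaximal (suc (suc i)) (suc (u + v) ∷ R) → suc i * (u * v) + suc c * i ≤ sum R
split-sum-bound c {i} {u} {v} {R} 1≤u 1≤v parts len max =
  *-cancelʳ-≤ _ _ x {{>-nonZero 1≤x}} (begin
    (suc i * (u * v) + suc c * i) * x      ≡⟨ distribute (suc i) (u * v) (suc c * i) x ⟩
    suc i * (u * v * x) + suc c * i * x    ≤⟨ +-monoˡ-≤ _ (*-monoʳ-≤ (suc i) (split-bound 1≤u 1≤v pos max)) ⟩
    suc i * cliques (suc i) R + suc c * i * x  ≤⟨ newton c parts i ⟩
    sum R * x                              ∎)
  where
  open ≤-Reasoning
  x = cliques i R
  pos : All (1 ≤_) R
  pos = All.map (≤-trans (s≤s z≤n)) parts
  1≤x : 1 ≤ x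
  1≤x = 1≤cliques i pos (≤-trans (n≤1+n i) len)
  distribute : ∀ p m q x → (p * m + q) * x ≡ p * (m * x) + q * x
  distribute = solve-∀

¬maximal-with-singleton : ∀ {i b Q} → 1 ≤ b → All (1 ≤_) Q → i ≤ length Q →
  ¬ CliqueMaximal (suc (suc i)) (suc (suc (b + b)) ∷ 1 ∷ Q)
¬maximal-with-singleton {i} {b} {Q} 1≤b pos len max =
  gain⇒≰ (rebalance-cliques b x y z) (*-mono-≤ (*-mono-≤ 1≤b (s≤s z≤n)) 1≤x)
    (max (suc b ∷ suc (suc b) ∷ Q) (s≤s z≤n ∷ s≤s z≤n ∷ pos) (s≤s z≤n)
      (rebalance-weight b (sum Q) (length Q)))
  where
  x = cliques i Q
  y = cliques (suc i) Q
  z = cliques (suc (suc i)) Q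
  1≤x : 1 ≤ x
  1≤x = 1≤cliques i pos len
  rebalance-weight : ∀ b s l → suc b + (suc (suc b) + s) + suc (suc l) ≡ suc (suc (b + b)) + (1 + s) + suc (suc l)
  rebalance-weight = solve-∀
  rebalance-cliques : ∀ b x y z → suc b * (suc (suc b) * x + y) + (suc (suc b) * y + z) + 0
    ≡ suc (suc (b + b)) * (1 * x + y) + (1 * y + z) + b * suc b * x
  rebalance-cliques = solve-∀

¬maximal-unbalanced : ∀ {r d R} → All (1 ≤_) R → ¬ CliqueMaximal 2 (suc (suc (r + d)) ∷ r ∷ R)
¬maximal-unbalanced {r} {d} {R} pos max =
  gain⇒≰ (transfer-cliques r d (cliques 1 R) (cliques 2 R)) (s≤s z≤n)
    (max (suc (r + d) ∷ suc r ∷ R) (s≤s z≤n ∷ s≤s z≤n ∷ pos) (s≤s z≤n)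
      (transfer-weight r d (sum R) (length R)))
  where
  transfer-weight : ∀ r d s l → suc (r + d) + (suc r + s) + suc (suc l) ≡ suc (suc (r + d)) + (r + s) + suc (suc l)
  transfer-weight = solve-∀
  transfer-cliques : ∀ r d y z → suc (r + d) * (suc r * 1 + y) + (suc r * y + z) + 0
    ≡ suc (suc (r + d)) * (r * 1 + y) + (r * y + z) + suc d
  transfer-cliques = solve-∀

¬maximal-halving : ∀ {b r R} → 1 ≤ b → b + b ≤ r → suc r + sum R ≤ b * suc b → All (1 ≤_) R →
  ¬ CliqueMaximal 2 (suc (suc (b + b)) ∷ suc r ∷ R)
¬maximal-halving {b} {r} {R} 1≤b 2b≤r small pos max =
  gain⇒≰ (halving-cliques b r y (cliques 2 R)) y+2≤b*b
    (max (suc b ∷ suc b ∷ r ∷ R) (s≤s z≤n ∷ s≤s z≤n ∷ 1≤r ∷ pos) (s≤s z≤n)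
      (halving-weight b r (sum R) (length R)))
  where
  y = cliques 1 R
  1≤r : 1 ≤ r
  1≤r = ≤-trans 1≤b (≤-trans (m≤m+n b b) 2b≤r)
  y+2≤b*b : suc (suc y) ≤ b * b
  y+2≤b*b = begin
    suc (suc y)  ≤⟨ +-monoˡ-≤ y (s≤s 1≤b) ⟩
    suc b + y    ≤⟨ +-cancelʳ-≤ b (suc b + y) (b * b) (begin
      suc b + y + b    ≡⟨ regroup b y ⟩
      suc (b + b) + y  ≤⟨ +-monoˡ-≤ y (s≤s 2b≤r) ⟩
      suc r + y        ≡⟨ cong (λ s → suc r + s) (cliques-one R) ⟩
      suc r + sum R    ≤⟨ small ⟩
      b * suc b        ≡⟨ *-suc b b ⟩
      b + b * b        ≡⟨ +-comm b (b * b) ⟩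
      b * b + b        ∎) ⟩
    b * b        ∎
    where
    open ≤-Reasoning
    regroup : ∀ b y → suc b + y + b ≡ suc (b + b) + y
    regroup = solve-∀
  halving-weight : ∀ b r s l →
    suc b + (suc b + (r + s)) + suc (suc (suc l)) ≡ suc (suc (b + b)) + (suc r + s) + suc (suc l)
  halving-weight = solve-∀
  halving-cliques : ∀ b r y z → suc b * (suc b * 1 + (r * 1 + y)) + (suc b * (r * 1 + y) + (r * y + z)) + suc y
    ≡ suc (suc (b + b)) * (suc r * 1 + y) + (suc r * y + z) + b * b
  halving-cliques = solve-∀

edge-bound : ∀ {b R} → 1 ≤ b → All (1 ≤_) R → 1 ≤ length R →
  CliqueMaximal 2 (suc (suc (b + b)) ∷ R) → b * suc b < sum R
edge-bound {b} {r ∷ R} 1≤b (_ ∷ pos) _ max with b * suc b <? r + sum R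
... | yes bound = bound
... | no ¬bound with r ≤? b + b
...   | yes r≤2b with d , r+d≡2b ← m≤n⇒∃[o]m+o≡n r≤2b =
  contradiction (subst (λ n → CliqueMaximal 2 (suc (suc n) ∷ r ∷ R)) (sym r+d≡2b) max)
    (¬maximal-unbalanced {r} {d} pos)
edge-bound {b} {suc r ∷ R} 1≤b (_ ∷ pos) _ max | no ¬bound | no r≰2b =
  contradiction max (¬maximal-halving 1≤b (≤-pred (≰⇒> r≰2b)) (≮⇒≥ ¬bound) pos)

one-or-all≥2 : ∀ {R} → All (1 ≤_) R → 1 ∈ R ⊎ All (2 ≤_) R
one-or-all≥2 {R} pos with any? (1 ≟_) R
... | yes 1∈R = inj₁ 1∈R
... | no  1∉R = inj₂ (All.zipWith (uncurry ≤∧≢⇒<) (pos , ¬Any⇒All¬ R 1∉R))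

even-part-bound : ∀ i {b R} → 1 ≤ b → All (1 ≤_) R → suc i ≤ length R →
  CliqueMaximal (suc (suc i)) (suc (suc (b + b)) ∷ R) → suc i * (b * suc b) + i < sum R
even-part-bound zero {b} {R} 1≤b pos len max = subst (_< sum R) (sym (identity (b * suc b))) (edge-bound 1≤b pos len max)
  where
  identity : ∀ m → 1 * m + 0 ≡ m
  identity = solve-∀
even-part-bound (suc i) {b} {R} 1≤b pos len max with one-or-all≥2 pos
... | inj₁ 1∈R with Q , R↭1∷Q ← ∈⇒↭∷ 1∈R =
  contradiction (CliqueMaximal-↭ (↭.prep _ R↭1∷Q) max) (¬maximal-with-singleton 1≤b pos-Q len-Q)
  where
  pos-Q : All (1 ≤_) Q
  pos-Q = All.tail (All-resp-↭ R↭1∷Q pos)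
  len-Q : suc i ≤ length Q
  len-Q = ≤-pred (subst (suc (suc i) ≤_) (↭-length R↭1∷Q) len)
... | inj₂ all≥2 = begin
  suc (m + suc i)      ≤⟨ m≤m+n _ i ⟩
  suc (m + suc i) + i  ≡⟨ spare m i ⟩
  m + 2 * suc i        ≤⟨ split-sum-bound 1 1≤b (s≤s z≤n) all≥2 len max′ ⟩
  sum R                ∎
  where
  open ≤-Reasoning
  m = suc (suc i) * (b * suc b)
  max′ : CliqueMaximal (suc (suc (suc i))) (suc (b + suc b) ∷ R)
  max′ = subst (λ n → CliqueMaximal (suc (suc (suc i))) (suc n ∷ R)) (sym (+-suc b b)) max
  spare : ∀ m i → suc (m + suc i) + i ≡ m + 2 * suc i
  spare = solve-∀

parity : ∀ n → (∃ λ b → n ≡ b + b) ⊎ (∃ λ b → n ≡ suc (b + b))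
parity zero    = inj₁ (0 , refl)
parity (suc n) with parity n
... | inj₁ (b , n≡2b)   = inj₂ (b , cong suc n≡2b)
... | inj₂ (b , n≡2b+1) = inj₁ (suc b , cong suc (trans n≡2b+1 (sym (+-suc b b))))

part-bound : ∀ i a₁ {R} → 2 ≤ a₁ → All (1 ≤_) R → suc i ≤ length R →
  CliqueMaximal (suc (suc i)) (suc a₁ ∷ R) → a₁ * a₁ * suc i + 3 * i ≤ 4 * sum R
part-bound i a₁ {R} 2≤a₁ pos len max with parity a₁
... | inj₁ (suc b , refl) = begin
  (suc b + suc b) * (suc b + suc b) * suc i + 3 * i      ≤⟨ m≤m+n _ i ⟩
  (suc b + suc b) * (suc b + suc b) * suc i + 3 * i + i  ≡⟨ odd-identity (suc b) i ⟩
  4 * (suc i * (suc b * suc b) + 1 * i)                  ≤⟨ *-monoʳ-≤ 4 halves-bound ⟩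
  4 * sum R                                              ∎
  where
  open ≤-Reasoning
  halves-bound : suc i * (suc b * suc b) + 1 * i ≤ sum R
  halves-bound = split-sum-bound 0 (s≤s z≤n) (s≤s z≤n) pos len max
  odd-identity : ∀ b i → (b + b) * (b + b) * suc i + 3 * i + i ≡ 4 * (suc i * (b * b) + 1 * i)
  odd-identity = solve-∀
... | inj₂ (b , refl) = begin
  suc (b + b) * suc (b + b) * suc i + 3 * i      ≤⟨ m≤m+n _ 3 ⟩
  suc (b + b) * suc (b + b) * suc i + 3 * i + 3  ≡⟨ even-identity b i ⟩
  4 * suc (suc i * (b * suc b) + i)              ≤⟨ *-monoʳ-≤ 4 (even-part-bound i (half b 2≤a₁) pos len max) ⟩
  4 * sum R                                      ∎
  where
  open ≤-Reasoning
  half : ∀ b → 2 ≤ suc (b + b) → 1 ≤ b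
  half zero    (s≤s ())
  half (suc b) _ = s≤s z≤n
  even-identity : ∀ b i → suc (b + b) * suc (b + b) * suc i + 3 * i + 3 ≡ 4 * suc (suc i * (b * suc b) + i)
  even-identity = solve-∀

SmallOrBounded : ℕ → ℕ → ℕ → Set
SmallOrBounded k n a = (a < 3) ⊎
  ((((+ a) -ℤ (+ 1)) *ℤ ((+ a) -ℤ (+ 1))) *ℤ ((+ k) -ℤ (+ 1))
    <ℤ ((((+ 4) *ℤ (+ n)) -ℤ ((+ 3) *ℤ (+ k))) +ℤ (+ 7)) -ℤ ((+ 4) *ℤ (+ a)))

bounded-from-ℕ : ∀ i a₁ s → a₁ * a₁ * suc i + 3 * i ≤ 4 * s →
  SmallOrBounded (suc (suc i)) (suc a₁ + s) (suc a₁)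
bounded-from-ℕ i a₁ s bound with d , eq ← m≤n⇒∃[o]m+o≡n bound =
  inj₂ (subst₂ _<ℤ_ lhs rhs (+<+ (m<m+n X z<s)))
  where
  open ≡-Reasoning
  X = a₁ * a₁ * suc i
  lhs : + X ≡ (+ a₁ *ℤ + a₁) *ℤ + suc i
  lhs = trans (pos-* (a₁ * a₁) (suc i)) (cong (_*ℤ + suc i) (pos-* a₁ a₁))
  cancel : ∀ X T D → X +ℤ (+ 1 +ℤ D) ≡ ((X +ℤ T +ℤ D) -ℤ T) +ℤ + 1
  cancel = ℤ-Solver.solve-∀
  normalise : ∀ A S I → ((+ 4 *ℤ S) -ℤ (+ 3 *ℤ I)) +ℤ + 1
    ≡ (((+ 4 *ℤ (+ 1 +ℤ A +ℤ S)) -ℤ (+ 3 *ℤ (+ 2 +ℤ I))) +ℤ + 7) -ℤ (+ 4 *ℤ (+ 1 +ℤ A))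
  normalise = ℤ-Solver.solve-∀
  rhs : + (X + suc d) ≡ (((+ 4 *ℤ + (suc a₁ + s)) -ℤ (+ 3 *ℤ + suc (suc i))) +ℤ + 7) -ℤ (+ 4 *ℤ + suc a₁)
  rhs = begin
    + (X + suc d)                                   ≡⟨ cancel (+ X) (+ (3 * i)) (+ d) ⟩
    (+ (X + 3 * i + d) -ℤ + (3 * i)) +ℤ + 1          ≡⟨ cong (λ n → (+ n -ℤ + (3 * i)) +ℤ + 1) eq ⟩
    (+ (4 * s) -ℤ + (3 * i)) +ℤ + 1                 ≡⟨ cong₂ (λ m n → (m -ℤ n) +ℤ + 1) (pos-* 4 s) (pos-* 3 i) ⟩
    ((+ 4 *ℤ + s) -ℤ (+ 3 *ℤ + i)) +ℤ + 1           ≡⟨ normalise (+ a₁) (+ s) (+ i) ⟩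
    (((+ 4 *ℤ + (suc a₁ + s)) -ℤ (+ 3 *ℤ + suc (suc i))) +ℤ + 7) -ℤ (+ 4 *ℤ + suc a₁) ∎

part-condition : ∀ k a {R} → 2 ≤ k → All (1 ≤_) R → k ≤ length (a ∷ R) →
  CliqueMaximal k (a ∷ R) → SmallOrBounded k (a + sum R) a
part-condition _ 0 _ _ _ _ = inj₁ (s≤s z≤n)
part-condition _ 1 _ _ _ _ = inj₁ (s≤s (s≤s z≤n))
part-condition _ 2 _ _ _ _ = inj₁ (s≤s (s≤s (s≤s z≤n)))
part-condition 1 (suc (suc (suc _))) (s≤s ()) _ _ _
part-condition (suc (suc i)) (suc (suc (suc c))) {R} _ pos (s≤s len) max =
  bounded-from-ℕ i (suc (suc c)) (sum R) (part-bound i (suc (suc c)) (s≤s (s≤s z≤n)) pos len max)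

sum-replicate-1 : ∀ n → sum (replicate n 1) ≡ n
sum-replicate-1 zero    = refl
sum-replicate-1 (suc n) = cong suc (sum-replicate-1 n)

admissible-2∷ones : ∀ t → Admissible (suc (suc t)) (2 ∷ replicate t 1)
admissible-2∷ones t = s≤s z≤n , s≤s z≤n ∷ replicate⁺ t (s≤s z≤n) , total
  where
  identity : ∀ t → 2 + t + suc t + 1 ≡ suc (suc t) + suc (suc t)
  identity = solve-∀
  total : 2 + sum (replicate t 1) + suc (length (replicate t 1)) + 1 ≡ suc (suc t) + suc (suc t)
  total rewrite sum-replicate-1 t | length-replicate t {1} = identity t

maximum-has-k-parts : ∀ {k t as} → k < t →
  (∀ bs → Admissible t bs → cliques k bs ≤ cliques k as) → k ≤ length as
maximum-has-k-parts {zero}              _                 _   = z≤n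
maximum-has-k-parts {suc k} {suc (suc t)} {as} (s≤s k<t+1) max =
  1≤cliques⇒≤length (suc k) as (≤-trans (1≤cliques (suc k) pos k≤length) (max _ (admissible-2∷ones t)))
  where
  pos : All (1 ≤_) (2 ∷ replicate t 1)
  pos = s≤s z≤n ∷ replicate⁺ t (s≤s z≤n)
  k≤length : suc k ≤ length (2 ∷ replicate t 1)
  k≤length = s≤s (subst (k ≤_) (sym (length-replicate t)) (≤-pred k<t+1))

lemma3p12 : (k t : ℕ) → 2 ≤ k → k < t → (as : List ℕ) → Admissible t as →
    ((bs : List ℕ) → Admissible t bs → cliques k bs ≤ cliques k as) →
    All (λ a → (a < 3) ⊎
      ((((+ a) -ℤ (+ 1)) *ℤ ((+ a) -ℤ (+ 1))) *ℤ ((+ k) -ℤ (+ 1))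
        <ℤ ((((+ 4) *ℤ (+ (sum as))) -ℤ ((+ 3) *ℤ (+ k))) +ℤ (+ 7)) -ℤ ((+ 4) *ℤ (+ a)))) as
lemma3p12 k t 2≤k k<t as (_ , pos , total) max = All.tabulate condition
  where
  maximal : CliqueMaximal k as
  maximal bs pos′ len′ weight≡ = max bs (len′ , pos′ , trans (cong (_+ 1) weight≡) total)
  condition : ∀ {a} → a ∈ as → SmallOrBounded k (sum as) a
  condition a∈as with R , as↭a∷R ← ∈⇒↭∷ a∈as =
    subst (λ n → SmallOrBounded k n _) (sym (sum-↭ as↭a∷R))
      (part-condition k _ 2≤k (All.tail (All-resp-↭ as↭a∷R pos))
        (subst (k ≤_) (↭-length as↭a∷R) (maximum-has-k-parts k<t max))
        (CliqueMaximal-↭ {k} as↭a∷R maximal))
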